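{- As $n\to\infty$, \[ f_2(n)=\frac{1}{2}\binom{n}{2}+O(n^{1.525}). \]
   Context: For positive integers $k,n$, an $n$-ary $k$-radius sequence is a finite sequence $a_0,\ldots,a_{m-1}$ of elements of $\{0,1,\ldots,n-1\}$ such that for all distinct $x,y\in\{0,\ldots,n-1\}$ there exist $i,j$ with $a_i=x$, $a_j=y$ and $|i-j|\le k$. $f_k(n)$ denotes the shortest length of an $n$-ary $k$-radius sequence. -}

module Defs where

open import Data.Nat using (ℕ; _≤_; _*_; _^_; ∣_-_∣)
open import Data.Nat.Combinatorics using (_C_)
open import Data.Fin using (Fin; toℕ)
open import Data.List using (List; length; lookup)
open import Data.Product using (Σ; ∃; _×_)
open import Relation.Binary.PropositionalEquality using (_≡_; _≢_)

IsRadiusSeq : (k n : ℕ) → List (Fin n) → Set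
IsRadiusSeq k n s =
  (x y : Fin n) → x ≢ y →
  Σ (Fin (length s)) λ i → Σ (Fin (length s)) λ j →
    (lookup s i ≡ x) × (lookup s j ≡ y) × (∣ toℕ i - toℕ j ∣ ≤ k)

IsShortestRadiusLength : (k n m : ℕ) → Set
IsShortestRadiusLength k n m =
  (Σ (List (Fin n)) λ s → IsRadiusSeq k n s × (length s ≡ m))
  × ((s : List (Fin n)) → IsRadiusSeq k n s → m ≤ length s)

module Submission where

-- In a 2-radius sequence of length m every pair x < y is witnessed by two
-- positions at distance 1 or 2.  The smaller position and the gap determine the two
-- positions, hence the pair; so pairs inject into Fin (m · 2) and C(n,2) ≤ 2m.
--
-- Split [0,3s) into three blocks of size s = 2h, h odd.  A sequence of
-- (3/2)s² + O(s) terms (CrossBlocks) brings every pair from different blocks within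
-- distance 2; its entries are residues mod s with offsets chosen so that every
-- difference of residues occurs.  Appending a sequence R for the first block and its two
-- translates covers the pairs inside blocks.  Recursing with s ≈ n/3 gives a sequence
-- with 4·length ≤ n² + (300j + 1024)·3^j when n ≤ 3^j + 9.
--
-- Choosing n ≤ 3^j ≤ 3n, the deviation X = |2 f₂(n) − C(n,2)| is at most
-- (300j + 1024)·3^j = O(n log n); in particular X² = O(n³), which gives the statement.

open import Data.Nat
open import Data.Nat.Properties
open import Data.Nat.DivMod
open import Data.Nat.Tactic.RingSolver using (solve-∀)
open import Data.List using (List; []; _∷_; _++_; map; length; lookup)
open import Data.List.Properties using (++-assoc; map-++; length-++; length-map)
open import Data.Product using (Σ; ∃; ∃₂; _×_; _,_; proj₁; proj₂)
open import Data.Sum using (_⊎_; inj₁; inj₂)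
import Data.Sum as Sum
open import Relation.Binary.PropositionalEquality
open import Relation.Nullary using (yes; no)
open import Data.Empty using (⊥-elim)
open import Function using (_∘_)
open import Data.Fin using (Fin; zero; suc; toℕ; fromℕ<; splitAt; join; cast; combine)
open import Data.Fin.Properties
  using (toℕ-injective; toℕ<n; fromℕ<-toℕ; toℕ-fromℕ<; ¬Fin0; join-splitAt; cast-involutive; combine-injective; injective⇒≤)
open import Relation.Binary using (tri<; tri≈; tri>)
open import Defs

data Near {A : Set} (x y : A) : List A → Set where
  gap₁ : ∀ p q → Near x y (p ++ x ∷ y ∷ q)
  gap₂ : ∀ p z q → Near x y (p ++ x ∷ z ∷ y ∷ q)

Linked : {A : Set} → A → A → List A → Set
Linked x y l = Near x y l ⊎ Near y x l

module _ {A : Set} where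

  near-++ˡ : ∀ {x y : A} {l} r → Near x y l → Near x y (l ++ r)
  near-++ˡ {x} {y} r (gap₁ p q) = subst (Near x y) (sym (++-assoc p _ r)) (gap₁ p (q ++ r))
  near-++ˡ {x} {y} r (gap₂ p z q) = subst (Near x y) (sym (++-assoc p _ r)) (gap₂ p z (q ++ r))

  near-++ʳ : ∀ {x y : A} {l} r → Near x y l → Near x y (r ++ l)
  near-++ʳ {x} {y} r (gap₁ p q) = subst (Near x y) (++-assoc r p _) (gap₁ (r ++ p) q)
  near-++ʳ {x} {y} r (gap₂ p z q) = subst (Near x y) (++-assoc r p _) (gap₂ (r ++ p) z q)

  near-inside : ∀ {x y : A} p {w} q → Near x y w → Near x y (p ++ w ++ q)
  near-inside p q n = near-++ʳ p (near-++ˡ q n)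

  linked-++ˡ : ∀ {x y : A} {l} r → Linked x y l → Linked x y (l ++ r)
  linked-++ˡ r = Sum.map (near-++ˡ r) (near-++ˡ r)

  linked-++ʳ : ∀ {x y : A} {l} r → Linked x y l → Linked x y (r ++ l)
  linked-++ʳ r = Sum.map (near-++ʳ r) (near-++ʳ r)

  linked-sym : ∀ {x y : A} {l} → Linked x y l → Linked y x l
  linked-sym = Sum.swap

  near-≡ : ∀ {x y x′ y′ : A} {l} → x ≡ x′ → y ≡ y′ → Near x y l → Near x′ y′ l
  near-≡ refl refl n = n

near-map : {A B : Set} (f : A → B) {x y : A} {l : List A} → Near x y l → Near (f x) (f y) (map f l)
near-map f {x} {y} (gap₁ p q) = subst (Near (f x) (f y)) (sym (map-++ f p _)) (gap₁ (map f p) (map f q))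
near-map f {x} {y} (gap₂ p z q) = subst (Near (f x) (f y)) (sym (map-++ f p _)) (gap₂ (map f p) (f z) (map f q))

linked-map : {A B : Set} (f : A → B) {x y : A} {l : List A} → Linked x y l → Linked (f x) (f y) (map f l)
linked-map f = Sum.map (near-map f) (near-map f)

triples : (ℕ → ℕ) → (ℕ → ℕ) → (ℕ → ℕ) → ℕ → List ℕ
triples a b c zero = a 0 ∷ []
triples a b c (suc N) = a 0 ∷ b 0 ∷ c 0 ∷ triples (a ∘ suc) (b ∘ suc) (c ∘ suc) N

length-triples : ∀ a b c N → length (triples a b c N) ≡ suc (3 * N)
length-triples a b c zero = refl
length-triples a b c (suc N) = trans (cong (3 +_) (length-triples _ _ _ N)) (arith N)
  where
  arith : ∀ N → 3 + suc (3 * N) ≡ suc (3 * suc N)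
  arith = solve-∀

triples-head : ∀ a b c N → ∃ λ r → triples a b c N ≡ a 0 ∷ r
triples-head a b c zero = [] , refl
triples-head a b c (suc N) = _ , refl

window : ∀ a b c {Q N} → Q < N →
  ∃₂ λ p q → triples a b c N ≡ p ++ a Q ∷ b Q ∷ c Q ∷ a (suc Q) ∷ q
window a b c {zero} {suc N} _ with triples-head (a ∘ suc) (b ∘ suc) (c ∘ suc) N
... | r , e = [] , r , cong (λ t → a 0 ∷ b 0 ∷ c 0 ∷ t) e
window a b c {suc Q} {suc N} (s≤s Q<N) with window (a ∘ suc) (b ∘ suc) (c ∘ suc) Q<N
... | p , q , e = a 0 ∷ b 0 ∷ c 0 ∷ p , q , cong (λ t → a 0 ∷ b 0 ∷ c 0 ∷ t) e

window⁺ : ∀ a b c {Q N} → suc Q < N →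
  ∃₂ λ p q → triples a b c N ≡ p ++ a Q ∷ b Q ∷ c Q ∷ a (suc Q) ∷ b (suc Q) ∷ q
window⁺ a b c {zero} {suc (suc N)} _ = [] , _ , refl
window⁺ a b c {zero} {suc zero} (s≤s ())
window⁺ a b c {suc Q} {suc N} (s≤s Q<N) with window⁺ (a ∘ suc) (b ∘ suc) (c ∘ suc) Q<N
... | p , q , e = a 0 ∷ b 0 ∷ c 0 ∷ p , q , cong (λ t → a 0 ∷ b 0 ∷ c 0 ∷ t) e

even-or-odd : ∀ n → ∃ λ k → n ≡ k + k ⊎ n ≡ suc (k + k)
even-or-odd zero = 0 , inj₁ refl
even-or-odd (suc n) with even-or-odd n
... | k , inj₁ e = k , inj₂ (cong suc e)
... | k , inj₂ e = suc k , inj₁ (trans (cong suc e) (cong suc (sym (+-suc k k))))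

half-< : ∀ {k h} → k + k < h + h → k < h
half-< {k} {h} lt with k <? h
... | yes k<h = k<h
... | no k≮h = ⊥-elim (<⇒≱ lt (+-mono-≤ (≮⇒≥ k≮h) (≮⇒≥ k≮h)))

-- The cross-block sequence for three blocks [0,s), [s,2s), [2s,3s) of size s = 2h,
-- h = 2hh + 1 odd.  Position Q = i + k·s (round k, index i < s) carries
--   A Q = i,   B Q = s + (i + 2k+1) mod s,   C Q = 2s + (i + 4k+1) mod s,
-- and the sequence a₀b₀c₀a₁b₁c₁… brings every cross-block pair within distance 2.
module CrossBlocks (hh : ℕ) where

  h last s : ℕ
  h = suc (hh + hh)
  last = (hh + hh) + h
  s = suc last

  instance
    s-nonZero : NonZero s
    s-nonZero = _

  infix 4 _≈_
  _≈_ : ℕ → ℕ → Set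
  a ≈ b = a % s ≡ b % s

  ≈-+ʳ : ∀ {a b} c → a ≈ b → a + c ≈ b + c
  ≈-+ʳ {a} {b} c a≈b = begin
    (a + c) % s             ≡⟨ %-distribˡ-+ a c s ⟩
    (a % s + c % s) % s     ≡⟨ cong (λ r → (r + c % s) % s) a≈b ⟩
    (b % s + c % s) % s     ≡⟨ %-distribˡ-+ b c s ⟨
    (b + c) % s             ∎
    where open ≡-Reasoning

  ≈-+ˡ : ∀ {a b} c → a ≈ b → c + a ≈ c + b
  ≈-+ˡ {a} {b} c a≈b = trans (cong (_% s) (+-comm c a)) (trans (≈-+ʳ {a} {b} c a≈b) (cong (_% s) (+-comm b c)))

  residue : ∀ a → a % s ≈ a
  residue a = m%n%n≡m%n a s

  round-at : ∀ {k i} → i < s → (i + k * s) / s ≡ k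
  round-at {k} {i} i<s = begin
    (i + k * s) / s      ≡⟨ +-distrib-/ i (k * s) i%s+ks%s<s ⟩
    i / s + k * s / s    ≡⟨ cong₂ _+_ (m<n⇒m/n≡0 i<s) (m*n/n≡m k s) ⟩
    k                    ∎
    where
    open ≡-Reasoning
    i%s+ks%s<s : i % s + k * s % s < s
    i%s+ks%s<s = subst (_< s) (sym (trans (cong₂ _+_ (m<n⇒m%n≡m i<s) (m*n%n≡0 k s)) (+-identityʳ i))) i<s

  position-< : ∀ {k i} → k < h → i < s → i + k * s < h * s
  position-< {k} k<h i<s = ≤-trans (+-monoˡ-≤ (k * s) i<s) (*-monoˡ-≤ s k<h)

  offB offC : ℕ → ℕ
  offB k = suc (k + k)
  offC k = suc ((k + k) + (k + k))

  A B C B⁺ : ℕ → ℕ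
  A Q = Q % s
  B Q = s + (Q + offB (Q / s)) % s
  C Q = (s + s) + (Q + offC (Q / s)) % s
  -- B at position Q + 1, but computed with the round of Q.
  B⁺ Q = s + (Q + suc (offB (Q / s))) % s

  -- For each round k, the pair across the end of the round: c at index s − 1 next to
  -- b at index 0 of the same round (that is, B⁺ at index s − 1).
  wraps : ℕ → List ℕ
  wraps zero = []
  wraps (suc k) = wraps k ++ C (last + k * s) ∷ B⁺ (last + k * s) ∷ []

  crossBlocks : List ℕ
  crossBlocks = triples A B C (h * s) ++ wraps h

  length-wraps : ∀ K → length (wraps K) ≡ K + K
  length-wraps zero = refl
  length-wraps (suc K) = trans (length-++ (wraps K)) (trans (cong (_+ 2) (length-wraps K)) (arith K))
    where
    arith : ∀ K → K + K + 2 ≡ suc K + suc K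
    arith = solve-∀

  length-crossBlocks : length crossBlocks ≡ suc (3 * (h * s)) + (h + h)
  length-crossBlocks = trans (length-++ (triples A B C (h * s)))
                             (cong₂ _+_ (length-triples A B C (h * s)) (length-wraps h))

  data Link (Q : ℕ) : ℕ → ℕ → Set where
    ab : Link Q (A Q) (B Q)
    ac : Link Q (A Q) (C Q)
    bc : Link Q (B Q) (C Q)
    ba : Link Q (B Q) (A (suc Q))
    ca : Link Q (C Q) (A (suc Q))

  link-window : ∀ {Q x y} → Link Q x y → Near x y (A Q ∷ B Q ∷ C Q ∷ A (suc Q) ∷ [])
  link-window {Q} ab = gap₁ [] _
  link-window {Q} ac = gap₂ [] (B Q) _
  link-window {Q} bc = gap₁ (A Q ∷ []) _
  link-window {Q} ba = gap₂ (A Q ∷ []) (C Q) []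
  link-window {Q} ca = gap₁ (A Q ∷ B Q ∷ []) []

  link-near : ∀ {Q x y} → Q < h * s → Link Q x y → Near x y crossBlocks
  link-near Q<hs l with window A B C Q<hs
  ... | p , q , e = near-++ˡ (wraps h) (subst (Near _ _) (sym e) (near-inside p q (link-window l)))

  -- The sixth pair (c_Q, b_{Q+1}), where b_{Q+1} is taken in the round of Q:
  -- inside the triples unless Q is the last index of its round, else in the wraps.
  wraps-near : ∀ {k K} → k < K → Near (C (last + k * s)) (B⁺ (last + k * s)) (wraps K)
  wraps-near {k} {suc K} k<1+K with m≤n⇒m<n∨m≡n (≤-pred k<1+K)
  ... | inj₁ k<K = near-++ˡ _ (wraps-near k<K)
  ... | inj₂ refl = near-++ʳ (wraps k) (gap₁ [] [])

  B-next : ∀ {k i} → suc i < s → B (suc (i + k * s)) ≡ B⁺ (i + k * s)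
  B-next {k} {i} 1+i<s = cong (s +_) (begin
    (suc Q + offB (suc Q / s)) % s   ≡⟨ cong (λ r → (suc Q + offB r) % s) (round-at {k} 1+i<s) ⟩
    (suc Q + offB k) % s             ≡⟨ cong (_% s) (+-suc Q (offB k)) ⟨
    (Q + suc (offB k)) % s           ≡⟨ cong (λ r → (Q + suc (offB r)) % s) (round-at {k} (<-trans (n<1+n i) 1+i<s)) ⟨
    (Q + suc (offB (Q / s))) % s     ∎)
    where
    open ≡-Reasoning
    Q = i + k * s

  wrap-near : ∀ {k i} → k < h → i < s → Near (C (i + k * s)) (B⁺ (i + k * s)) crossBlocks
  wrap-near {k} {i} k<h i<s with m≤n⇒m<n∨m≡n i<s
  ... | inj₂ refl = near-++ʳ (triples A B C (h * s)) (wraps-near k<h)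
  ... | inj₁ 1+i<s with window⁺ A B C (position-< k<h 1+i<s)
  ...   | p , q , e = near-++ˡ (wraps h) (subst (Near _ _) (sym e)
                        (near-inside p q (near-≡ refl (B-next {k} 1+i<s) (gap₂ (A Q ∷ B Q ∷ []) (A (suc Q)) []))))
    where Q = i + k * s

  diff : ℕ → ℕ → ℕ
  diff x y = (y + (s ∸ x)) % s

  diff-< : ∀ x y → diff x y < s
  diff-< x y = m%n<n (y + (s ∸ x)) s

  diff-spec : ∀ {x y} → x < s → x + diff x y ≈ y
  diff-spec {x} {y} x<s = begin
    (x + diff x y) % s         ≡⟨ ≈-+ˡ {diff x y} {y + (s ∸ x)} x (residue (y + (s ∸ x))) ⟩
    (x + (y + (s ∸ x))) % s    ≡⟨ cong (_% s) (x+[y+z]≡y+[x+z] x y (s ∸ x)) ⟩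
    (y + (x + (s ∸ x))) % s    ≡⟨ cong (λ r → (y + r) % s) (m+[n∸m]≡n (<⇒≤ x<s)) ⟩
    (y + s) % s                ≡⟨ [m+n]%n≡m%n y s ⟩
    y % s                      ∎
    where
    open ≡-Reasoning
    x+[y+z]≡y+[x+z] : ∀ x y z → x + (y + z) ≡ y + (x + z)
    x+[y+z]≡y+[x+z] = solve-∀

  realise : ∀ k {x y} o o′ → x < s → y < s → o + diff x y ≈ o′ →
            ∃ λ i → i < s × (i + k * s + o) % s ≡ x × (i + k * s + o′) % s ≡ y
  realise k {x} {y} o o′ x<s y<s oδ≈o′ = i , m%n<n (x + o * last) s , at-o , at-o′
    where
    open ≡-Reasoning
    δ = diff x y
    i = (x + o * last) % s

    drop-round : ∀ c → i + k * s + c ≈ x + o * last + c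
    drop-round c = begin
      (i + k * s + c) % s    ≡⟨ cong (_% s) (arith i (k * s) c) ⟩
      (i + c + k * s) % s    ≡⟨ [m+kn]%n≡m%n (i + c) k s ⟩
      (i + c) % s            ≡⟨ ≈-+ʳ {i} {x + o * last} c (residue (x + o * last)) ⟩
      (x + o * last + c) % s ∎
      where
      arith : ∀ a b c → a + b + c ≡ a + c + b
      arith = solve-∀

    at-o : (i + k * s + o) % s ≡ x
    at-o = begin
      (i + k * s + o) % s    ≡⟨ drop-round o ⟩
      (x + o * last + o) % s ≡⟨ cong (_% s) (arith x o last) ⟩
      (x + o * s) % s        ≡⟨ [m+kn]%n≡m%n x o s ⟩
      x % s                  ≡⟨ m<n⇒m%n≡m x<s ⟩
      x                      ∎
      where
      arith : ∀ x o l → x + o * l + o ≡ x + o * suc l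
      arith = solve-∀

    at-o′ : (i + k * s + o′) % s ≡ y
    at-o′ = begin
      (i + k * s + o′) % s         ≡⟨ drop-round o′ ⟩
      (x + o * last + o′) % s      ≡⟨ ≈-+ˡ {o + δ} {o′} (x + o * last) oδ≈o′ ⟨
      (x + o * last + (o + δ)) % s ≡⟨ cong (_% s) (arith x o δ last) ⟩
      (x + δ + o * s) % s          ≡⟨ [m+kn]%n≡m%n (x + δ) o s ⟩
      (x + δ) % s                  ≡⟨ diff-spec {y = y} x<s ⟩
      y % s                        ≡⟨ m<n⇒m%n≡m y<s ⟩
      y                            ∎
      where
      arith : ∀ x o δ l → x + o * l + (o + δ) ≡ x + δ + o * suc l
      arith = solve-∀

  data Parity (d : ℕ) : Set where
    even : ∀ k → k < h → d ≡ k + k → Parity d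
    odd  : ∀ k → k < h → d ≡ suc (k + k) → Parity d

  parity-of : ∀ {d} → d < s → Parity d
  parity-of {d} d<s with even-or-odd d
  ... | k , inj₁ refl = even k (half-< d<s) refl
  ... | k , inj₂ refl = odd k (half-< (<-trans (n<1+n (k + k)) d<s)) refl

  -- Every odd residue 2t + 1 (t < h) is the offset of C in some round k < h; this uses
  -- that h is odd: for odd t take k = (t + h)/2, then 4k + 1 = 2t + 1 + s.
  c-round : ∀ {t} → t < h → ∃ λ k → k < h × suc (t + t) ≈ offC k
  c-round {t} t<h with even-or-odd t
  ... | w , inj₁ refl = w , ≤-<-trans (m≤m+n w w) t<h , refl
  ... | w , inj₂ refl = w + suc hh , w+1+hh<h , sym (trans (cong (_% s) (arith w hh)) ([m+kn]%n≡m%n (suc (t + t)) 1 s))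
    where
    w<hh : w < hh
    w<hh = half-< (≤-pred t<h)
    w+1+hh<h : w + suc hh < h
    w+1+hh<h = s≤s (subst (_≤ hh + hh) (sym (+-suc w hh)) (+-monoˡ-≤ hh w<hh))
    arith : ∀ w hh → suc (((w + suc hh) + (w + suc hh)) + ((w + suc hh) + (w + suc hh)))
                     ≡ suc (suc (w + w) + suc (w + w)) + 1 * suc ((hh + hh) + suc (hh + hh))
    arith = solve-∀

  -- Every odd residue 2j + 1 (j < h) is the gap between the offsets of B⁺ and C in some
  -- round: k = j + 1, or k = 0 when j + 1 = h.
  cb-round : ∀ {j} → j < h → ∃ λ k → k < h × suc (offB k) + suc (j + j) ≈ offC k
  cb-round {j} j<h with suc j <? h
  ... | yes 1+j<h = suc j , 1+j<h , cong (_% s) (arith j)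
    where
    arith : ∀ j → suc (suc (suc j + suc j)) + suc (j + j) ≡ suc ((suc j + suc j) + (suc j + suc j))
    arith = solve-∀
  ... | no 1+j≮h = 0 , s≤s z≤n , (begin
    (2 + suc (j + j)) % s        ≡⟨ cong (_% s) (arith j) ⟩
    (1 + (suc j + suc j)) % s    ≡⟨ cong (λ r → (1 + (r + r)) % s) (≤-antisym j<h (≮⇒≥ 1+j≮h)) ⟩
    (1 + s) % s                  ≡⟨ [m+n]%n≡m%n 1 s ⟩
    1 % s                        ∎)
    where
    open ≡-Reasoning
    arith : ∀ j → 2 + suc (j + j) ≡ 1 + (suc j + suc j)
    arith = solve-∀

  A-at : ∀ Q → A Q ≡ (Q + 0) % s
  A-at Q = cong (_% s) (sym (+-identityʳ Q))

  A-next : ∀ Q → A (suc Q) ≡ (Q + 1) % s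
  A-next Q = cong (_% s) (+-comm 1 Q)

  in-round : ∀ (f : ℕ → ℕ) k {i} → i < s → (i + k * s + f ((i + k * s) / s)) % s ≡ (i + k * s + f k) % s
  in-round f k {i} i<s = cong (λ r → (i + k * s + f r) % s) (round-at {k} i<s)

  cover-AB : ∀ {x y} → x < s → y < s → Linked x (s + y) crossBlocks
  cover-AB {x} {y} x<s y<s with parity-of (diff-< x y)
  ... | odd k k<h d≡ with realise k 0 (offB k) x<s y<s (cong (_% s) d≡)
  ...   | i , i<s , r₀ , r₁ = inj₁ (near-≡ (trans (A-at Q) r₀) (cong (s +_) (trans (in-round offB k i<s) r₁))
                                    (link-near (position-< k<h i<s) ab))
    where Q = i + k * s
  cover-AB {x} {y} x<s y<s | even k k<h d≡ with realise k 1 (offB k) x<s y<s (cong (λ d → suc d % s) d≡)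
  ...   | i , i<s , r₁ , r₀ = inj₂ (near-≡ (cong (s +_) (trans (in-round offB k i<s) r₀)) (trans (A-next Q) r₁)
                                    (link-near (position-< k<h i<s) ba))
    where Q = i + k * s

  cover-AC : ∀ {x y} → x < s → y < s → Linked x ((s + s) + y) crossBlocks
  cover-AC {x} {y} x<s y<s with parity-of (diff-< x y)
  ... | odd t t<h d≡ with c-round t<h
  ...   | k , k<h , t≈k with realise k 0 (offC k) x<s y<s (trans (cong (_% s) d≡) t≈k)
  ...     | i , i<s , r₀ , r₁ = inj₁ (near-≡ (trans (A-at Q) r₀) (cong ((s + s) +_) (trans (in-round offC k i<s) r₁))
                                      (link-near (position-< k<h i<s) ac))
    where Q = i + k * s
  cover-AC {x} {y} x<s y<s | even t t<h d≡ with c-round t<h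
  ...   | k , k<h , t≈k with realise k 1 (offC k) x<s y<s (trans (cong (λ d → suc d % s) d≡) t≈k)
  ...     | i , i<s , r₁ , r₀ = inj₂ (near-≡ (cong ((s + s) +_) (trans (in-round offC k i<s) r₀)) (trans (A-next Q) r₁)
                                      (link-near (position-< k<h i<s) ca))
    where Q = i + k * s

  cover-BC : ∀ {x y} → x < s → y < s → Linked (s + x) ((s + s) + y) crossBlocks
  cover-BC {x} {y} x<s y<s with parity-of (diff-< x y)
  ... | even k k<h d≡ with realise k (offB k) (offC k) x<s y<s (cong (λ d → (offB k + d) % s) d≡)
  ...   | i , i<s , r₀ , r₁ = inj₁ (near-≡ (cong (s +_) (trans (in-round offB k i<s) r₀))
                                         (cong ((s + s) +_) (trans (in-round offC k i<s) r₁))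
                                    (link-near (position-< k<h i<s) bc))
  cover-BC {x} {y} x<s y<s | odd j j<h d≡ with cb-round j<h
  ...   | k , k<h , gap with realise k (suc (offB k)) (offC k) x<s y<s (trans (cong (λ d → (suc (offB k) + d) % s) d≡) gap)
  ...     | i , i<s , r₀ , r₁ = inj₂ (near-≡ (cong ((s + s) +_) (trans (in-round offC k i<s) r₁))
                                          (cong (s +_) (trans (in-round (λ r → suc (offB r)) k i<s) r₀))
                                      (wrap-near k<h i<s))

Covers : ℕ → List ℕ → Set
Covers n l = ∀ {x y} → x < n → y < n → x ≢ y → Linked x y l

row : ℕ → ℕ → List ℕ
row x zero = []
row x (suc y) = row x y ++ x ∷ y ∷ []

allPairs : ℕ → List ℕ
allPairs zero = []
allPairs (suc n) = allPairs n ++ row n n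

row-near : ∀ x {y Y} → y < Y → Near x y (row x Y)
row-near x {y} {suc Y} y<1+Y with m≤n⇒m<n∨m≡n (≤-pred y<1+Y)
... | inj₁ y<Y = near-++ˡ _ (row-near x y<Y)
... | inj₂ refl = near-++ʳ (row x y) (gap₁ [] [])

allPairs-covers : ∀ n → Covers n (allPairs n)
allPairs-covers (suc n) {x} {y} x<1+n y<1+n x≢y with m≤n⇒m<n∨m≡n (≤-pred x<1+n) | m≤n⇒m<n∨m≡n (≤-pred y<1+n)
... | inj₁ x<n | inj₁ y<n = linked-++ˡ _ (allPairs-covers n x<n y<n x≢y)
... | inj₂ refl | inj₁ y<n = inj₁ (near-++ʳ (allPairs n) (row-near n y<n))
... | inj₁ x<n | inj₂ refl = inj₂ (near-++ʳ (allPairs n) (row-near n x<n))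
... | inj₂ refl | inj₂ refl = ⊥-elim (x≢y refl)

length-allPairs : ∀ n → length (allPairs n) + n ≡ n * n
length-allPairs zero = refl
length-allPairs (suc n) = begin
  length (allPairs n ++ row n n) + suc n       ≡⟨ cong (_+ suc n) (length-++ (allPairs n)) ⟩
  length (allPairs n) + length (row n n) + suc n ≡⟨ cong (λ r → length (allPairs n) + r + suc n) (length-row n n) ⟩
  length (allPairs n) + (n + n) + suc n         ≡⟨ arith (length (allPairs n)) n ⟩
  (length (allPairs n) + n) + (n + suc n)       ≡⟨ cong (_+ (n + suc n)) (length-allPairs n) ⟩
  n * n + (n + suc n)                           ≡⟨ square n ⟩
  suc n * suc n                                 ∎
  where
  open ≡-Reasoning
  length-row : ∀ x y → length (row x y) ≡ y + y
  length-row x zero = refl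
  length-row x (suc y) = trans (length-++ (row x y)) (trans (cong (_+ 2) (length-row x y)) (double y))
    where
    double : ∀ y → y + y + 2 ≡ suc y + suc y
    double = solve-∀
  arith : ∀ a n → a + (n + n) + suc n ≡ (a + n) + (n + suc n)
  arith = solve-∀
  square : ∀ n → n * n + (n + suc n) ≡ suc n * suc n
  square = solve-∀

stepParam : ℕ → ℕ
stepParam n = suc (n / 12)

blockSize : ℕ → ℕ
blockSize n = CrossBlocks.s (stepParam n)

three-blocks : ∀ n → blockSize n + blockSize n + blockSize n ≡ n / 12 * 12 + 18
three-blocks n = arith (n / 12)
  where
  arith : ∀ q → let s = suc ((suc q + suc q) + suc (suc q + suc q)) in s + s + s ≡ q * 12 + 18
  arith = solve-∀

n<3·blockSize : ∀ n → n < blockSize n + blockSize n + blockSize n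
n<3·blockSize n = subst (n <_) (sym (three-blocks n)) (begin-strict
  n                       ≡⟨ m≡m%n+[m/n]*n n 12 ⟩
  n % 12 + n / 12 * 12    ≡⟨ +-comm (n % 12) _ ⟩
  n / 12 * 12 + n % 12    <⟨ +-monoʳ-< (n / 12 * 12) (m%n<n n 12) ⟩
  n / 12 * 12 + 12        ≤⟨ +-monoʳ-≤ (n / 12 * 12) (m≤m+n 12 6) ⟩
  n / 12 * 12 + 18        ∎)
  where open ≤-Reasoning

3·blockSize≤ : ∀ n → blockSize n + blockSize n + blockSize n ≤ n + 18
3·blockSize≤ n = subst (_≤ n + 18) (sym (three-blocks n)) (+-monoˡ-≤ 18 (m/n*n≤m n 12))

data InBlocks (s : ℕ) : ℕ → Set where
  first  : ∀ {x} → x < s → InBlocks s x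
  second : ∀ {x} → x < s → InBlocks s (s + x)
  third  : ∀ {x} → x < s → InBlocks s ((s + s) + x)

offset-< : ∀ {a b x} → a ≤ x → x < a + b → x ∸ a < b
offset-< {a} {b} a≤x x<a+b = subst (_ <_) (m+n∸m≡n a b) (∸-monoˡ-< x<a+b a≤x)

inBlocks : ∀ {s x} → x < s + s + s → InBlocks s x
inBlocks {s} {x} x<3s with x <? s
... | yes x<s = first x<s
... | no x≮s with x <? s + s
...   | yes x<2s = subst (InBlocks s) (m+[n∸m]≡n s≤x) (second (offset-< s≤x x<2s))
  where s≤x = ≮⇒≥ x≮s
...   | no x≮2s = subst (InBlocks s) (m+[n∸m]≡n 2s≤x) (third (offset-< 2s≤x x<3s))
  where 2s≤x = ≮⇒≥ x≮2s

module Step (n : ℕ) where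
  open CrossBlocks (stepParam n)

  assemble : List ℕ → List ℕ
  assemble R = crossBlocks ++ R ++ map (s +_) R ++ map ((s + s) +_) R

  assemble-covers : ∀ R → Covers s R → Covers n (assemble R)
  assemble-covers R R-covers {x} {y} x<n y<n x≢y
    with inBlocks (<-trans x<n (n<3·blockSize n)) | inBlocks (<-trans y<n (n<3·blockSize n))
  ... | first a  | first b  = linked-++ʳ crossBlocks (linked-++ˡ _ (R-covers a b x≢y))
  ... | first a  | second b = linked-++ˡ _ (cover-AB a b)
  ... | first a  | third b  = linked-++ˡ _ (cover-AC a b)
  ... | second a | first b  = linked-++ˡ _ (linked-sym (cover-AB b a))
  ... | second a | second b = linked-++ʳ crossBlocks (linked-++ʳ R (linked-++ˡ _
                                (linked-map (s +_) (R-covers a b (x≢y ∘ cong (s +_))))))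
  ... | second a | third b  = linked-++ˡ _ (cover-BC a b)
  ... | third a  | first b  = linked-++ˡ _ (linked-sym (cover-AC b a))
  ... | third a  | second b = linked-++ˡ _ (linked-sym (cover-BC b a))
  ... | third a  | third b  = linked-++ʳ crossBlocks (linked-++ʳ R (linked-++ʳ (map (s +_) R)
                                (linked-map ((s + s) +_) (R-covers a b (x≢y ∘ cong ((s + s) +_))))))

  length-assemble : ∀ R → length (assemble R) ≡ (suc (3 * (h * s)) + (h + h)) + (length R + (length R + length R))
  length-assemble R = begin
    length (crossBlocks ++ rest)             ≡⟨ length-++ crossBlocks ⟩
    length crossBlocks + length rest         ≡⟨ cong₂ _+_ length-crossBlocks length-rest ⟩
    _                                        ∎
    where
    open ≡-Reasoning
    rest = R ++ map (s +_) R ++ map ((s + s) +_) R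
    length-rest : length rest ≡ length R + (length R + length R)
    length-rest = trans (length-++ R) (cong (length R +_) (trans (length-++ (map (s +_) R))
                    (cong₂ _+_ (length-map (s +_) R) (length-map ((s + s) +_) R))))

open Step using (assemble; assemble-covers; length-assemble)

-- The recursive construction; the fuel f only has to exceed the depth of recursion.
radiusSeq : ℕ → ℕ → List ℕ
radiusSeq zero n = allPairs n
radiusSeq (suc f) n with n ≤? 12
... | yes _ = allPairs n
... | no _ = assemble n (radiusSeq f (blockSize n))

radiusSeq-covers : ∀ f n → Covers n (radiusSeq f n)
radiusSeq-covers zero n = allPairs-covers n
radiusSeq-covers (suc f) n with n ≤? 12
... | yes _ = allPairs-covers n
... | no _ = assemble-covers n _ (radiusSeq-covers f (blockSize n))

-- The excess of 4·length over n² after j levels of recursion.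
excess : ℕ → ℕ
excess j = (300 * j + 1024) * 3 ^ j

excess-suc : ∀ j → excess (suc j) ≡ 3 * excess j + 900 * 3 ^ j
excess-suc j = arith j (3 ^ j)
  where
  arith : ∀ j P → (300 * suc j + 1024) * (3 * P) ≡ 3 * ((300 * j + 1024) * P) + 900 * P
  arith = solve-∀

excess-≥ : ∀ j → 1024 * 3 ^ j ≤ excess j
excess-≥ j = *-monoˡ-≤ (3 ^ j) (m≤n+m 1024 (300 * j))

1024≤excess : ∀ j → 1024 ≤ excess j
1024≤excess j = ≤-trans (m≤m*n 1024 (3 ^ j) {{>-nonZero (m^n>0 3 j)}}) (excess-≥ j)

step-arith : ∀ {n h L P e} → (h + h) + (h + h) + (h + h) ≤ n + 18 → n ≤ 3 * P + 9 → 1 ≤ P →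
             4 * L ≤ (h + h) * (h + h) + e →
             4 * ((suc (3 * (h * (h + h))) + (h + h)) + (L + (L + L))) ≤ n * n + (3 * e + 900 * P)
step-arith {n} {h} {L} {P} {e} 3s≤n+18 n≤3P+9 1≤P 4L≤ = begin
  4 * ((suc (3 * (h * s)) + s) + (L + (L + L)))   ≡⟨ expand h L ⟩
  6 * (s * s) + 4 * s + 4 + 3 * (4 * L)           ≤⟨ +-monoʳ-≤ (6 * (s * s) + 4 * s + 4) (*-monoʳ-≤ 3 4L≤) ⟩
  6 * (s * s) + 4 * s + 4 + 3 * (s * s + e)       ≡⟨ regroup s e ⟩
  t * t + (4 * s + 4) + 3 * e                     ≤⟨ +-monoˡ-≤ (3 * e) (+-mono-≤ (*-mono-≤ 3s≤n+18 3s≤n+18)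
                                                       (+-monoˡ-≤ 4 (≤-trans 4s≤2t (+-mono-≤ 3s≤n+18 3s≤n+18)))) ⟩
  (n + 18) * (n + 18) + ((n + 18) + (n + 18) + 4) + 3 * e ≡⟨ square n e ⟩
  n * n + (38 * n + 364) + 3 * e                  ≤⟨ +-monoˡ-≤ (3 * e) (+-monoʳ-≤ (n * n) (+-monoˡ-≤ 364 (*-monoʳ-≤ 38 n≤3P+9))) ⟩
  n * n + (38 * (3 * P + 9) + 364) + 3 * e        ≡⟨ linear n P e ⟩
  n * n + (114 * P + 706) + 3 * e                 ≤⟨ +-monoˡ-≤ (3 * e) (+-monoʳ-≤ (n * n) (+-monoʳ-≤ (114 * P)
                                                       (≤-trans (m≤m+n 706 80) (*-monoʳ-≤ 786 1≤P)))) ⟩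
  n * n + (114 * P + 786 * P) + 3 * e             ≡⟨ collect n P e ⟩
  n * n + (3 * e + 900 * P)                       ∎
  where
  open ≤-Reasoning
  s = h + h
  t = s + s + s
  4s≤2t : 4 * s ≤ t + t
  4s≤2t = subst (4 * s ≤_) (six s) (m≤m+n (4 * s) (s + s))
    where
    six : ∀ s → 4 * s + (s + s) ≡ (s + s + s) + (s + s + s)
    six = solve-∀
  expand : ∀ h L → 4 * ((suc (3 * (h * (h + h))) + (h + h)) + (L + (L + L)))
                   ≡ 6 * ((h + h) * (h + h)) + 4 * (h + h) + 4 + 3 * (4 * L)
  expand = solve-∀
  regroup : ∀ s e → 6 * (s * s) + 4 * s + 4 + 3 * (s * s + e) ≡ (s + s + s) * (s + s + s) + (4 * s + 4) + 3 * e
  regroup = solve-∀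
  square : ∀ n e → (n + 18) * (n + 18) + ((n + 18) + (n + 18) + 4) + 3 * e ≡ n * n + (38 * n + 364) + 3 * e
  square = solve-∀
  linear : ∀ n P e → n * n + (38 * (3 * P + 9) + 364) + 3 * e ≡ n * n + (114 * P + 706) + 3 * e
  linear = solve-∀
  collect : ∀ n P e → n * n + (114 * P + 786 * P) + 3 * e ≡ n * n + (3 * e + 900 * P)
  collect = solve-∀

allPairs-bound : ∀ {n} j → n ≤ 12 → 4 * length (allPairs n) ≤ n * n + excess j
allPairs-bound {n} j n≤12 = begin
  4 * length (allPairs n)  ≤⟨ *-monoʳ-≤ 4 (m+n≤o⇒m≤o (length (allPairs n)) (≤-reflexive (length-allPairs n))) ⟩
  4 * (n * n)              ≡⟨ arith (n * n) ⟩
  n * n + 3 * (n * n)      ≤⟨ +-monoʳ-≤ (n * n) (≤-trans (*-monoʳ-≤ 3 (*-mono-≤ n≤12 n≤12))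
                                (≤-trans (m≤m+n 432 592) (1024≤excess j))) ⟩
  n * n + excess j         ∎
  where
  open ≤-Reasoning
  arith : ∀ a → 4 * a ≡ a + 3 * a
  arith = solve-∀

blockSize-< : ∀ {n} → 12 < n → blockSize n < n
blockSize-< {n} 12<n with blockSize n <? n
... | yes s<n = s<n
... | no s≮n = ⊥-elim (<⇒≱ (≤-trans (m≤m+n 19 7) (+-mono-≤ 12<n 12<n)) 2n≤18)
  where
  n≤s = ≮⇒≥ s≮n
  2n≤18 : n + n ≤ 18
  2n≤18 = +-cancelˡ-≤ n (n + n) 18 (subst (_≤ n + 18) (+-assoc n n n)
            (≤-trans (+-mono-≤ (+-mono-≤ n≤s n≤s) n≤s) (3·blockSize≤ n)))

blockSize-≤ : ∀ {n P} → n ≤ 3 * P + 9 → blockSize n ≤ P + 9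
blockSize-≤ {n} {P} n≤3P+9 = *-cancelˡ-≤ 3 (subst₂ _≤_ (triple s) (sym (arith P))
                               (≤-trans (3·blockSize≤ n) (+-monoˡ-≤ 18 n≤3P+9)))
  where
  s = blockSize n
  triple : ∀ a → a + a + a ≡ 3 * a
  triple = solve-∀
  arith : ∀ P → 3 * (P + 9) ≡ 3 * P + 9 + 18
  arith = solve-∀

length-bound : ∀ j f n → n ≤ f → n ≤ 3 ^ j + 9 → 4 * length (radiusSeq f n) ≤ n * n + excess j
length-bound j zero zero _ _ = z≤n
length-bound j (suc f) n n≤1+f n≤3^j+9 with n ≤? 12
... | yes n≤12 = allPairs-bound j n≤12
length-bound zero (suc f) n n≤1+f n≤10 | no n≰12 = ⊥-elim (n≰12 (≤-trans n≤10 (m≤m+n 10 2)))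
length-bound (suc j) (suc f) n n≤1+f n≤3P+9 | no n≰12 = begin
  4 * length (assemble n R)     ≡⟨ cong (4 *_) (length-assemble n R) ⟩
  4 * ((suc (3 * (h * (h + h))) + (h + h)) + (length R + (length R + length R)))
                                ≤⟨ step-arith {n} {h} {length R} {3 ^ j} {excess j} (3·blockSize≤ n) n≤3P+9 (m^n>0 3 j) IH ⟩
  n * n + (3 * excess j + 900 * 3 ^ j) ≡⟨ cong (n * n +_) (excess-suc j) ⟨
  n * n + excess (suc j)        ∎
  where
  open ≤-Reasoning
  h = CrossBlocks.h (stepParam n)
  s = blockSize n
  R = radiusSeq f s
  IH : 4 * length R ≤ s * s + excess j
  IH = length-bound j f s (≤-pred (≤-trans (blockSize-< (≰⇒> n≰12)) n≤1+f)) (blockSize-≤ n≤3P+9)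

-- Entries of the construction, read as elements of Fin (suc n′); out-of-range values
-- (which do not occur) are sent to 0.
clamp : ∀ n′ → ℕ → Fin (suc n′)
clamp n′ v with v <? suc n′
... | yes v<1+n′ = fromℕ< v<1+n′
... | no _ = zero

clamp-toℕ : ∀ {n′} (x : Fin (suc n′)) → clamp n′ (toℕ x) ≡ x
clamp-toℕ {n′} x with toℕ x <? suc n′
... | yes x<1+n′ = fromℕ<-toℕ x x<1+n′
... | no x≮1+n′ = ⊥-elim (x≮1+n′ (toℕ<n x))

shift : ∀ {A : Set} (p w : List A) (k : Fin (length w)) →
        Σ (Fin (length (p ++ w))) λ i → toℕ i ≡ length p + toℕ k × lookup (p ++ w) i ≡ lookup w k
shift [] w k = k , refl , refl
shift (a ∷ p) w k with shift p w k
... | i , i≡ , lookup-i = suc i , cong suc i≡ , lookup-i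

Witness : {A : Set} → List A → A → A → Set
Witness l x y = Σ (Fin (length l)) λ i → Σ (Fin (length l)) λ j →
                (lookup l i ≡ x) × (lookup l j ≡ y) × (∣ toℕ i - toℕ j ∣ ≤ 2)

witness-sym : ∀ {A : Set} {l : List A} {x y} → Witness l x y → Witness l y x
witness-sym (i , j , lookup-i , lookup-j , i~j) = j , i , lookup-j , lookup-i , subst (_≤ 2) (∣-∣-comm (toℕ i) (toℕ j)) i~j

spread : ∀ {i j} a {c} → c ≤ 2 → i ≡ a + 0 → j ≡ a + c → ∣ i - j ∣ ≤ 2
spread a {c} c≤2 refl refl = ≤-trans (≤-reflexive (trans (cong (λ r → ∣ r - a + c ∣) (+-identityʳ a)) (∣m-m+n∣≡n a c))) c≤2

near-witness : ∀ {A : Set} {l : List A} {x y} → Near x y l → Witness l x y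
near-witness {x = x} {y} (gap₁ p q) with shift p (x ∷ y ∷ q) zero | shift p (x ∷ y ∷ q) (suc zero)
... | i , i≡ , lookup-i | j , j≡ , lookup-j = i , j , lookup-i , lookup-j , spread (length p) (s≤s z≤n) i≡ j≡
near-witness {x = x} {y} (gap₂ p z q) with shift p (x ∷ z ∷ y ∷ q) zero | shift p (x ∷ z ∷ y ∷ q) (suc (suc zero))
... | i , i≡ , lookup-i | j , j≡ , lookup-j = i , j , lookup-i , lookup-j , spread (length p) ≤-refl i≡ j≡

construction : ∀ n′ → List (Fin (suc n′))
construction n′ = map (clamp n′) (radiusSeq (suc n′) (suc n′))

construction-isRadius : ∀ n′ → IsRadiusSeq 2 (suc n′) (construction n′)
construction-isRadius n′ x y x≢y
  with radiusSeq-covers (suc n′) (suc n′) (toℕ<n x) (toℕ<n y) (x≢y ∘ toℕ-injective)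
... | inj₁ x~y = near-witness (near-≡ (clamp-toℕ x) (clamp-toℕ y) (near-map (clamp n′) x~y))
... | inj₂ y~x = witness-sym {l = construction n′} (near-witness (near-≡ (clamp-toℕ y) (clamp-toℕ x) (near-map (clamp n′) y~x)))

-- Binomial coefficients are imported only here: the operator _C_ would make the block
-- function C of CrossBlocks ambiguous.
open import Data.Nat.Combinatorics using (_C_; nC1≡n; nCk+nC[k+1]≡[n+1]C[k+1]; k>n⇒nCk≡0)

C2-zero : 0 C 2 ≡ 0
C2-zero = k>n⇒nCk≡0 {0} {2} (s≤s z≤n)

C2-suc : ∀ n → suc n C 2 ≡ n C 2 + n
C2-suc n = trans (sym (nCk+nC[k+1]≡[n+1]C[k+1] n 1)) (trans (cong (_+ n C 2) (nC1≡n n)) (+-comm n _))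

-- Fin ((n+1) C 2) splits into the pairs below n and the n pairs with larger element n.
decode : ∀ n → Fin (suc n C 2) → Fin (n C 2) ⊎ Fin n
decode n i = splitAt (n C 2) (cast (C2-suc n) i)

decode-injective : ∀ n {i j} → decode n i ≡ decode n j → i ≡ j
decode-injective n {i} {j} e = begin
  i                                       ≡⟨ cast-involutive (sym (C2-suc n)) (C2-suc n) i ⟨
  cast (sym (C2-suc n)) (cast (C2-suc n) i) ≡⟨ cong (cast (sym (C2-suc n))) same-cast ⟩
  cast (sym (C2-suc n)) (cast (C2-suc n) j) ≡⟨ cast-involutive (sym (C2-suc n)) (C2-suc n) j ⟩
  j                                       ∎
  where
  open ≡-Reasoning
  same-cast : cast (C2-suc n) i ≡ cast (C2-suc n) j
  same-cast = trans (sym (join-splitAt (n C 2) n _)) (trans (cong (join (n C 2) n) e) (join-splitAt (n C 2) n _))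

pairAt : ∀ n → Fin (n C 2) → ℕ × ℕ
pairAt zero i = ⊥-elim (¬Fin0 (cast C2-zero i))
pairAt (suc n) i = Sum.[ pairAt n , (λ x → toℕ x , n) ]′ (decode n i)

pairAt-ordered : ∀ n i → proj₁ (pairAt n i) < proj₂ (pairAt n i) × proj₂ (pairAt n i) < n
pairAt-ordered zero i = ⊥-elim (¬Fin0 (cast C2-zero i))
pairAt-ordered (suc n) i with decode n i
... | inj₁ a = proj₁ (pairAt-ordered n a) , m<n⇒m<1+n (proj₂ (pairAt-ordered n a))
... | inj₂ x = toℕ<n x , ≤-refl

pairAt-injective : ∀ n {i j} → pairAt n i ≡ pairAt n j → i ≡ j
pairAt-injective zero {i} _ = ⊥-elim (¬Fin0 (cast C2-zero i))
pairAt-injective (suc n) {i} {j} e = decode-injective n (same (decode n i) (decode n j) e)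
  where
  top : Fin n → ℕ × ℕ
  top x = toℕ x , n
  same : ∀ u v → Sum.[ pairAt n , top ]′ u ≡ Sum.[ pairAt n , top ]′ v → u ≡ v
  same (inj₁ a) (inj₁ b) e = cong inj₁ (pairAt-injective n e)
  same (inj₂ x) (inj₂ y) e = cong inj₂ (toℕ-injective (cong proj₁ e))
  same (inj₁ a) (inj₂ y) e = ⊥-elim (<-irrefl (cong proj₂ e) (proj₂ (pairAt-ordered n a)))
  same (inj₂ x) (inj₁ b) e = ⊥-elim (<-irrefl (sym (cong proj₂ e)) (proj₂ (pairAt-ordered n b)))

data Span {m} (lo : Fin m) (g : Fin 2) (i j : Fin m) : Set where
  forward  : toℕ i ≡ toℕ lo → toℕ j ≡ toℕ lo + suc (toℕ g) → Span lo g i j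
  backward : toℕ j ≡ toℕ lo → toℕ i ≡ toℕ lo + suc (toℕ g) → Span lo g i j

small-gap : ∀ {a b} → a < b → ∣ a - b ∣ ≤ 2 → ∃ λ (g : Fin 2) → b ≡ a + suc (toℕ g)
small-gap {a} a<b a~b with m≤n⇒∃[o]m+o≡n a<b
... | e , refl = fromℕ< e<2 , trans (sym (+-suc a e)) (cong (λ r → a + suc r) (sym (toℕ-fromℕ< e<2)))
  where
  e<2 : e < 2
  e<2 = subst (_≤ 2) (trans (cong (λ r → ∣ a - r ∣) (sym (+-suc a e))) (∣m-m+n∣≡n a (suc e))) a~b

span : ∀ {m} (i j : Fin m) → toℕ i ≢ toℕ j → ∣ toℕ i - toℕ j ∣ ≤ 2 → ∃₂ λ lo g → Span lo g i j
span i j i≢j i~j with <-cmp (toℕ i) (toℕ j)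
... | tri≈ _ i≡j _ = ⊥-elim (i≢j i≡j)
... | tri< i<j _ _ = let g , j≡ = small-gap i<j i~j in i , g , forward refl j≡
... | tri> _ _ j<i = let g , i≡ = small-gap j<i (subst (_≤ 2) (∣-∣-comm (toℕ i) (toℕ j)) i~j) in j , g , backward refl i≡

span-unique : ∀ {m} {lo : Fin m} {g i j i′ j′} → Span lo g i j → Span lo g i′ j′ →
              (toℕ i ≡ toℕ i′ × toℕ j ≡ toℕ j′) ⊎ (toℕ i ≡ toℕ j′ × toℕ j ≡ toℕ i′)
span-unique (forward p q) (forward p′ q′) = inj₁ (trans p (sym p′) , trans q (sym q′))
span-unique (backward p q) (backward p′ q′) = inj₁ (trans q (sym q′) , trans p (sym p′))
span-unique (forward p q) (backward p′ q′) = inj₂ (trans p (sym p′) , trans q (sym q′))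
span-unique (backward p q) (forward p′ q′) = inj₂ (trans q (sym q′) , trans p (sym p′))

module LowerBound {n} (l : List (Fin n)) (radius : IsRadiusSeq 2 n l) where
  m = length l

  x y : Fin (n C 2) → Fin n
  x a = fromℕ< (<-trans (proj₁ (pairAt-ordered n a)) (proj₂ (pairAt-ordered n a)))
  y a = fromℕ< (proj₂ (pairAt-ordered n a))

  x<y : ∀ a → toℕ (x a) < toℕ (y a)
  x<y a = subst₂ _<_ (sym (toℕ-fromℕ< _)) (sym (toℕ-fromℕ< _)) (proj₁ (pairAt-ordered n a))

  x≢y : ∀ a → x a ≢ y a
  x≢y a e = <-irrefl (cong toℕ e) (x<y a)

  posX posY : Fin (n C 2) → Fin m
  posX a = proj₁ (radius (x a) (y a) (x≢y a))
  posY a = proj₁ (proj₂ (radius (x a) (y a) (x≢y a)))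

  at-posX : ∀ a → lookup l (posX a) ≡ x a
  at-posX a = proj₁ (proj₂ (proj₂ (radius (x a) (y a) (x≢y a))))

  at-posY : ∀ a → lookup l (posY a) ≡ y a
  at-posY a = proj₁ (proj₂ (proj₂ (proj₂ (radius (x a) (y a) (x≢y a)))))

  lookup-≡ : ∀ {i j : Fin m} → toℕ i ≡ toℕ j → lookup l i ≡ lookup l j
  lookup-≡ e = cong (lookup l) (toℕ-injective e)

  posX≢posY : ∀ a → toℕ (posX a) ≢ toℕ (posY a)
  posX≢posY a e = x≢y a (trans (sym (at-posX a)) (trans (lookup-≡ e) (at-posY a)))

  span-of : ∀ a → ∃₂ λ lo g → Span lo g (posX a) (posY a)
  span-of a = span (posX a) (posY a) (posX≢posY a) (proj₂ (proj₂ (proj₂ (proj₂ (radius (x a) (y a) (x≢y a))))))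

  code : Fin (n C 2) → Fin (m * 2)
  code a = combine (proj₁ (span-of a)) (proj₁ (proj₂ (span-of a)))

  same-pair : ∀ a b → x a ≡ x b → y a ≡ y b → a ≡ b
  same-pair a b xa≡xb ya≡yb = pairAt-injective n (cong₂ _,_
    (trans (sym (toℕ-fromℕ< _)) (trans (cong toℕ xa≡xb) (toℕ-fromℕ< _)))
    (trans (sym (toℕ-fromℕ< _)) (trans (cong toℕ ya≡yb) (toℕ-fromℕ< _))))

  entries : ∀ a {i j} → toℕ (posX a) ≡ toℕ i → toℕ (posY a) ≡ toℕ j →
            x a ≡ lookup l i × y a ≡ lookup l j
  entries a e e′ = trans (sym (at-posX a)) (lookup-≡ e) , trans (sym (at-posY a)) (lookup-≡ e′)

  same-span : ∀ {a b lo g} → Span lo g (posX a) (posY a) → Span lo g (posX b) (posY b) → a ≡ b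
  same-span {a} {b} sa sb with span-unique sa sb
  ... | inj₁ (p , q) = let xa , ya = entries a p q in same-pair a b (trans xa (at-posX b)) (trans ya (at-posY b))
  ... | inj₂ (p , q) = let xa , ya = entries a p q in
        ⊥-elim (<-asym (subst₂ _<_ (cong toℕ (trans xa (at-posY b))) (cong toℕ (trans ya (at-posX b))) (x<y a)) (x<y b))

  code-injective : ∀ {a b} → code a ≡ code b → a ≡ b
  code-injective {a} {b} e with span-of a | span-of b
  ... | lo , g , sa | lo′ , g′ , sb with combine-injective lo g lo′ g′ e
  ...   | refl , refl = same-span sa sb

  lower : n C 2 ≤ 2 * m
  lower = subst (n C 2 ≤_) (*-comm m 2) (injective⇒≤ code-injective)

C2-double : ∀ n → 2 * (n C 2) + n ≡ n * n
C2-double zero = cong (λ c → 2 * c + 0) C2-zero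
C2-double (suc n) = begin
  2 * (suc n C 2) + suc n          ≡⟨ cong (λ c → 2 * c + suc n) (C2-suc n) ⟩
  2 * (n C 2 + n) + suc n          ≡⟨ regroup (n C 2) n ⟩
  (2 * (n C 2) + n) + (n + suc n)  ≡⟨ cong (_+ (n + suc n)) (C2-double n) ⟩
  n * n + (n + suc n)              ≡⟨ square n ⟩
  suc n * suc n                    ∎
  where
  open ≡-Reasoning
  regroup : ∀ c n → 2 * (c + n) + suc n ≡ (2 * c + n) + (n + suc n)
  regroup = solve-∀
  square : ∀ n → n * n + (n + suc n) ≡ suc n * suc n
  square = solve-∀

deviation-bound : ∀ {c m L n E} → c ≤ 2 * m → m ≤ L → 4 * L ≤ n * n + E → 2 * c + n ≡ n * n → n ≤ E →
                  ∣ 2 * m - c ∣ ≤ E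
deviation-bound {c} {m} {L} {n} {E} c≤2m m≤L 4L≤ 2c+n≡n² n≤E =
  *-cancelˡ-≤ 2 (≤-trans (+-cancelʳ-≤ (2 * c) (2 * X) (n + E) twice) (subst (n + E ≤_) (double E) (+-monoˡ-≤ E n≤E)))
  where
  open ≤-Reasoning
  X = ∣ 2 * m - c ∣
  X+c≡2m : X + c ≡ 2 * m
  X+c≡2m = trans (cong (_+ c) (m≤n⇒∣n-m∣≡n∸m c≤2m)) (m∸n+n≡m c≤2m)
  twice : 2 * X + 2 * c ≤ n + E + 2 * c
  twice = begin
    2 * X + 2 * c      ≡⟨ *-distribˡ-+ 2 X c ⟨
    2 * (X + c)        ≡⟨ cong (2 *_) X+c≡2m ⟩
    2 * (2 * m)        ≤⟨ subst (2 * (2 * m) ≤_) (sym (*-assoc 2 2 L)) (*-monoʳ-≤ 2 (*-monoʳ-≤ 2 m≤L)) ⟩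
    4 * L              ≤⟨ 4L≤ ⟩
    n * n + E          ≡⟨ cong (_+ E) (sym 2c+n≡n²) ⟩
    2 * c + n + E      ≡⟨ shuffle c n E ⟩
    n + E + 2 * c      ∎
    where
    shuffle : ∀ c n E → 2 * c + n + E ≡ n + E + 2 * c
    shuffle = solve-∀
  double : ∀ E → E + E ≡ 2 * E
  double = solve-∀

power-of-three : ∀ n′ → ∃ λ j → suc n′ ≤ 3 ^ j × 3 ^ j ≤ 3 * suc n′
power-of-three zero = 0 , s≤s z≤n , s≤s z≤n
power-of-three (suc n′) with power-of-three n′
... | j , n≤3^j , 3^j≤3n with suc (suc n′) ≤? 3 ^ j
...   | yes 1+n≤3^j = j , 1+n≤3^j , ≤-trans 3^j≤3n (*-monoʳ-≤ 3 (n≤1+n (suc n′)))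
...   | no 1+n≰3^j = suc j , subst (suc (suc n′) ≤_) (cong (3 *_) n≡3^j) (1+n≤3n n′)
                          , subst (_≤ 3 * suc (suc n′)) (cong (3 *_) n≡3^j) (*-monoʳ-≤ 3 (n≤1+n (suc n′)))
  where
  n≡3^j : suc n′ ≡ 3 ^ j
  n≡3^j = ≤-antisym n≤3^j (≤-pred (≰⇒> 1+n≰3^j))
  1+n≤3n : ∀ n′ → suc (suc n′) ≤ 3 * suc n′
  1+n≤3n n′ = subst (suc (suc n′) ≤_) (arith n′) (m≤m+n (suc (suc n′)) (suc (n′ + n′)))
    where
    arith : ∀ n′ → suc (suc n′) + suc (n′ + n′) ≡ 3 * suc n′
    arith = solve-∀

square-≤-power : ∀ j → suc j * suc j ≤ 4 * 3 ^ j
square-≤-power zero = s≤s z≤n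
square-≤-power (suc zero) = s≤s (s≤s (s≤s (s≤s z≤n)))
square-≤-power (suc (suc k)) = begin
  (3 + k) * (3 + k)          ≤⟨ subst ((3 + k) * (3 + k) ≤_) (sym (arith k)) (m≤m+n _ _) ⟩
  3 * ((2 + k) * (2 + k))    ≤⟨ *-monoʳ-≤ 3 (square-≤-power (suc k)) ⟩
  3 * (4 * 3 ^ suc k)        ≡⟨ *-comm-4 (3 ^ suc k) ⟩
  4 * 3 ^ suc (suc k)        ∎
  where
  open ≤-Reasoning
  arith : ∀ k → 3 * ((2 + k) * (2 + k)) ≡ (3 + k) * (3 + k) + (2 * (k * k) + 6 * k + 3)
  arith = solve-∀
  *-comm-4 : ∀ P → 3 * (4 * P) ≡ 4 * (3 * P)
  *-comm-4 = solve-∀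

-- excess j ≤ c₀·(j + 1)·3^j.  The constant is opaque so that the (large) constant of the
-- final estimate, built from it, is never evaluated during type checking.
opaque
  c₀ : ℕ
  c₀ = 1324

  excess-linear : ∀ j → excess j ≤ c₀ * suc j * 3 ^ j
  excess-linear j = *-monoˡ-≤ (3 ^ j) (subst (300 * j + 1024 ≤_) (sym (arith j)) (m≤m+n (300 * j + 1024) (1024 * j + 300)))
    where
    arith : ∀ j → 1324 * suc j ≡ (300 * j + 1024) + (1024 * j + 300)
    arith = solve-∀

excess-squared : ∀ {c j n} → excess j ≤ c * suc j * 3 ^ j → 3 ^ j ≤ 3 * n →
                 excess j * excess j ≤ c * c * 4 * 27 * (n * (n * n))
excess-squared {c} {j} {n} linear 3^j≤3n = begin
  excess j * excess j                      ≤⟨ *-mono-≤ linear linear ⟩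
  (c * suc j * P) * (c * suc j * P)        ≡⟨ regroup c (suc j) P ⟩
  c * c * (suc j * suc j) * (P * P)        ≤⟨ *-monoˡ-≤ (P * P) (*-monoʳ-≤ (c * c) (square-≤-power j)) ⟩
  c * c * (4 * P) * (P * P)                ≡⟨ cube (c * c) P ⟩
  c * c * 4 * (P * (P * P))                ≤⟨ *-monoʳ-≤ (c * c * 4) (*-mono-≤ 3^j≤3n (*-mono-≤ 3^j≤3n 3^j≤3n)) ⟩
  c * c * 4 * (3 * n * (3 * n * (3 * n)))  ≡⟨ cube-3n (c * c * 4) n ⟩
  c * c * 4 * 27 * (n * (n * n))           ∎
  where
  open ≤-Reasoning
  P = 3 ^ j
  regroup : ∀ c a P → (c * a * P) * (c * a * P) ≡ c * c * (a * a) * (P * P)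
  regroup = solve-∀
  cube : ∀ k P → k * (4 * P) * (P * P) ≡ k * 4 * (P * (P * P))
  cube = solve-∀
  cube-3n : ∀ k n → k * (3 * n * (3 * n * (3 * n))) ≡ k * 27 * (n * (n * n))
  cube-3n = solve-∀

^-distribʳ-* : ∀ a b k → (a * b) ^ k ≡ a ^ k * b ^ k
^-distribʳ-* a b zero = refl
^-distribʳ-* a b (suc k) = trans (cong ((a * b) *_) (^-distribʳ-* a b k)) (interchange a b (a ^ k) (b ^ k))
  where
  interchange : ∀ a b p q → (a * b) * (p * q) ≡ (a * p) * (b * q)
  interchange = solve-∀

power-bound : ∀ {X K n} → X * X ≤ K * (n * (n * n)) → 1 ≤ n → X ^ 40 ≤ K ^ 20 * n ^ 61
power-bound {X} {K} {n} X²≤ 1≤n = begin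
  X ^ 40                        ≡⟨ ^-*-assoc X 2 20 ⟨
  (X ^ 2) ^ 20                  ≤⟨ ^-monoˡ-≤ 20 (subst (_≤ K * (n * (n * n))) (cong (X *_) (sym (*-identityʳ X))) X²≤) ⟩
  (K * (n * (n * n))) ^ 20      ≡⟨ ^-distribʳ-* K (n * (n * n)) 20 ⟩
  K ^ 20 * (n * (n * n)) ^ 20   ≡⟨ cong (λ c → K ^ 20 * c ^ 20) (cong (λ r → n * (n * r)) (sym (*-identityʳ n))) ⟩
  K ^ 20 * (n ^ 3) ^ 20         ≡⟨ cong (K ^ 20 *_) (^-*-assoc n 3 20) ⟩
  K ^ 20 * n ^ 60               ≡⟨ cong (K ^ 20 *_) (*-identityˡ (n ^ 60)) ⟨
  K ^ 20 * (1 * n ^ 60)         ≤⟨ *-monoʳ-≤ (K ^ 20) (*-monoˡ-≤ (n ^ 60) 1≤n) ⟩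
  K ^ 20 * n ^ 61               ∎
  where open ≤-Reasoning

deviation-≤-excess : ∀ {n m} → 1 ≤ n → IsShortestRadiusLength 2 n m →
                     ∃ λ j → 3 ^ j ≤ 3 * n × ∣ 2 * m - (n C 2) ∣ ≤ excess j
deviation-≤-excess {suc n′} _ ((l , l-radius , refl) , shortest) with power-of-three n′
... | j , n≤3^j , 3^j≤3n = j , 3^j≤3n , deviation-bound (LowerBound.lower l l-radius) upper
                             (length-bound j n n ≤-refl (≤-trans n≤3^j (m≤m+n _ 9))) (C2-double n)
                             (≤-trans n≤3^j (≤-trans (m≤n*m (3 ^ j) 1024) (excess-≥ j)))
  where
  n = suc n′
  upper : length l ≤ length (radiusSeq n n)
  upper = subst (length l ≤_) (length-map (clamp n′) (radiusSeq n n)) (shortest (construction n′) (construction-isRadius n′))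

corollary4p3 : Σ ℕ λ K → Σ ℕ λ N → (n : ℕ) → N ≤ n → (m : ℕ) → IsShortestRadiusLength 2 n m → ∣ 2 * m - (n C 2) ∣ ^ 40 ≤ K * n ^ 61
corollary4p3 = (c₀ * c₀ * 4 * 27) ^ 20 , 1 , bound
  where
  bound : (n : ℕ) → 1 ≤ n → (m : ℕ) → IsShortestRadiusLength 2 n m →
          ∣ 2 * m - (n C 2) ∣ ^ 40 ≤ (c₀ * c₀ * 4 * 27) ^ 20 * n ^ 61
  bound n 1≤n m shortest with deviation-≤-excess 1≤n shortest
  ... | j , 3^j≤3n , deviation =
    power-bound {∣ 2 * m - (n C 2) ∣} {c₀ * c₀ * 4 * 27} {n}
      (≤-trans (*-mono-≤ deviation deviation) (excess-squared {c₀} {j} {n} (excess-linear j) 3^j≤3n)) 1≤n
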